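{- For every integer $n\geq 0$, $$\sum_{l=0}^{n}\binom{2n}{2l}\binom{2l+2n}{2n}=\sum_{l=0}^{n-1}\binom{2n}{2l+1}\binom{2n+2l+1}{2n}+1,$$ $$\sum_{l=0}^{n}\binom{2n+1}{2l}\binom{2l+2n+1}{2n+1}=\sum_{l=0}^{n}\binom{2n+1}{2l+1}\binom{2n+2l+2}{2n+1}-1.$$ -}

module Defs where

open import Data.Nat using (ℕ; zero; suc; _+_)

sumTo : ℕ → (ℕ → ℕ) → ℕ
sumTo zero    f = 0
sumTo (suc m) f = sumTo m f + f m

-- Both identities are the even and odd cases of one alternating sum,
--
--     ∑_{k=0}^{N} (-1)^k C(N,k) C(N+k,N) = (-1)^N ,                   (★)
--
-- read off by separating even from odd k: the even terms minus the odd
-- terms equal +1 when N = 2n and -1 when N = 2n+1.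
--
-- (★) is the instance s = N of  ∑_k (-1)^k C(n,k) C(s+k,n) = (-1)^n,  which
-- is proved by induction on n from a single "summation by parts" step for
-- the alternating binomial transform  alt n f = ∑_{k≤n} (-1)^k C(n,k) f(k):
-- if f(k+1) = f(k) + g(k) for all k then  alt (n+1) f = - alt n g.
-- Pascal's rule makes k ↦ C(s+k,n) the difference of k ↦ C(s+k,n+1).
module Submission where

open import Defs
open import Data.Nat using (ℕ; _+_; _*_)
open import Data.Nat.Combinatorics using (_C_)
open import Data.Product using (_×_)
open import Relation.Binary.PropositionalEquality using (_≡_)

open import Data.Nat using (zero; suc; _≤_; _<_; z<s; _≤′_; ≤′-refl; ≤′-step)
open import Data.Nat.Properties
  using (+-comm; +-assoc; +-identityʳ; *-suc; m<m+n; <-trans; ≤-reflexive; ≤′⇒≤; ≤⇒≤′)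
open import Data.Nat.Combinatorics using (k>n⇒nCk≡0; nCk+nC[k+1]≡[n+1]C[k+1])
import Data.Integer as ℤ
open ℤ using (ℤ; +_; 0ℤ; 1ℤ; -1ℤ)
import Data.Integer.Properties as ℤₚ
open import Algebra.Properties.AbelianGroup ℤₚ.+-0-abelianGroup using (⁻¹-anti-homo‿-)
open import Data.Integer.Tactic.RingSolver using (solve-∀)
import Data.Nat.Tactic.RingSolver as ℕ-Solver
open import Data.Product using (_,_)
open import Relation.Binary.PropositionalEquality
  using (refl; sym; trans; cong; cong₂; module ≡-Reasoning)
open ≡-Reasoning

∑ : ℕ → (ℕ → ℤ) → ℤ
∑ zero    f = 0ℤ
∑ (suc m) f = ∑ m f ℤ.+ f m

∑-cong : ∀ m {f g : ℕ → ℤ} → (∀ k → f k ≡ g k) → ∑ m f ≡ ∑ m g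
∑-cong zero    eq = refl
∑-cong (suc m) eq = cong₂ ℤ._+_ (∑-cong m eq) (eq m)

∑-shift : ∀ m f → ∑ (suc m) f ≡ f 0 ℤ.+ ∑ m (λ k → f (suc k))
∑-shift zero    f = trans (ℤₚ.+-identityˡ (f 0)) (sym (ℤₚ.+-identityʳ (f 0)))
∑-shift (suc m) f = begin
  ∑ (suc m) f ℤ.+ f (suc m)                          ≡⟨ cong (ℤ._+ f (suc m)) (∑-shift m f) ⟩
  (f 0 ℤ.+ ∑ m (λ k → f (suc k))) ℤ.+ f (suc m)      ≡⟨ ℤₚ.+-assoc (f 0) _ _ ⟩
  f 0 ℤ.+ ∑ (suc m) (λ k → f (suc k))                ∎

∑-minus : ∀ m f g → ∑ m (λ k → f k ℤ.- g k) ≡ ∑ m f ℤ.- ∑ m g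
∑-minus zero    f g = refl
∑-minus (suc m) f g = trans (cong (ℤ._+ (f m ℤ.- g m)) (∑-minus m f g))
                            (interchange (∑ m f) (∑ m g) (f m) (g m))
  where
  interchange : ∀ a b c d → (a ℤ.- b) ℤ.+ (c ℤ.- d) ≡ (a ℤ.+ c) ℤ.- (b ℤ.+ d)
  interchange = solve-∀

∑-pad : ∀ {n m} (f : ℕ → ℤ) → (∀ k → n ≤ k → f k ≡ 0ℤ) → n ≤′ m → ∑ m f ≡ ∑ n f
∑-pad f vanish ≤′-refl = refl
∑-pad {n} f vanish (≤′-step {m} n≤′m) = begin
  ∑ m f ℤ.+ f m   ≡⟨ cong (ℤ._+_ (∑ m f)) (vanish m (≤′⇒≤ n≤′m)) ⟩
  ∑ m f ℤ.+ 0ℤ    ≡⟨ ℤₚ.+-identityʳ (∑ m f) ⟩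
  ∑ m f           ≡⟨ ∑-pad f vanish n≤′m ⟩
  ∑ n f           ∎

∑-parity : ∀ M f → ∑ (2 * M) f ≡ ∑ M (λ l → f (2 * l) ℤ.+ f (2 * l + 1))
∑-parity zero    f = refl
∑-parity (suc M) f = begin
  ∑ (2 * suc M) f                                  ≡⟨ cong (λ m → ∑ m f) (*-suc 2 M) ⟩
  (∑ (2 * M) f ℤ.+ f (2 * M)) ℤ.+ f (suc (2 * M))  ≡⟨ ℤₚ.+-assoc (∑ (2 * M) f) _ _ ⟩
  ∑ (2 * M) f ℤ.+ (f (2 * M) ℤ.+ f (suc (2 * M)))
    ≡⟨ cong₂ ℤ._+_ (∑-parity M f) (cong (λ i → f (2 * M) ℤ.+ f i) (+-comm 1 (2 * M))) ⟩
  ∑ (suc M) (λ l → f (2 * l) ℤ.+ f (2 * l + 1))    ∎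

∑-fromℕ : ∀ m (f : ℕ → ℕ) → + sumTo m f ≡ ∑ m (λ k → + f k)
∑-fromℕ zero    f = refl
∑-fromℕ (suc m) f = trans (ℤₚ.pos-+ (sumTo m f) (f m)) (cong (ℤ._+ + f m) (∑-fromℕ m f))

sumTo-cong : ∀ m {f g : ℕ → ℕ} → (∀ k → f k ≡ g k) → sumTo m f ≡ sumTo m g
sumTo-cong zero    eq = refl
sumTo-cong (suc m) eq = cong₂ _+_ (sumTo-cong m eq) (eq m)

sign-even : ∀ l → -1ℤ ℤ.^ (2 * l) ≡ 1ℤ
sign-even l = trans (sym (ℤₚ.^-*-assoc -1ℤ 2 l)) (ℤₚ.^-zeroˡ l)

sign-odd : ∀ l → -1ℤ ℤ.^ (2 * l + 1) ≡ -1ℤ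
sign-odd l = begin
  -1ℤ ℤ.^ (2 * l + 1)          ≡⟨ ℤₚ.^-distribˡ-+-* -1ℤ (2 * l) 1 ⟩
  -1ℤ ℤ.^ (2 * l) ℤ.* -1ℤ ℤ.^ 1 ≡⟨ cong (ℤ._* -1ℤ ℤ.^ 1) (sign-even l) ⟩
  -1ℤ                          ∎

-- weight n k = (-1)^k C(n,k), the coefficients of the n-th difference.
weight : ℕ → ℕ → ℤ
weight n k = -1ℤ ℤ.^ k ℤ.* + (n C k)

-- C(n,k) = 0 beyond k = n, so the transform has only n+1 nonzero terms.
weight-vanish : ∀ n k → n < k → weight n k ≡ 0ℤ
weight-vanish n k n<k = begin
  -1ℤ ℤ.^ k ℤ.* + (n C k) ≡⟨ cong (λ c → -1ℤ ℤ.^ k ℤ.* + c) (k>n⇒nCk≡0 n<k) ⟩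
  -1ℤ ℤ.^ k ℤ.* 0ℤ        ≡⟨ ℤₚ.*-zeroʳ (-1ℤ ℤ.^ k) ⟩
  0ℤ                      ∎

weight-pascal : ∀ n k → weight (suc n) (suc k) ≡ weight n (suc k) ℤ.- weight n k
weight-pascal n k = begin
  -1ℤ ℤ.* σ ℤ.* + (suc n C suc k)
    ≡⟨ cong (λ c → -1ℤ ℤ.* σ ℤ.* + c) (sym (nCk+nC[k+1]≡[n+1]C[k+1] n k)) ⟩
  -1ℤ ℤ.* σ ℤ.* + (n C k + n C suc k)
    ≡⟨ cong (-1ℤ ℤ.* σ ℤ.*_) (ℤₚ.pos-+ (n C k) (n C suc k)) ⟩
  -1ℤ ℤ.* σ ℤ.* (+ (n C k) ℤ.+ + (n C suc k))
    ≡⟨ distribute σ (+ (n C k)) (+ (n C suc k)) ⟩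
  -1ℤ ℤ.* σ ℤ.* + (n C suc k) ℤ.- σ ℤ.* + (n C k) ∎
  where
  σ = -1ℤ ℤ.^ k
  distribute : ∀ s a b → -1ℤ ℤ.* s ℤ.* (a ℤ.+ b) ≡ -1ℤ ℤ.* s ℤ.* b ℤ.- s ℤ.* a
  distribute = solve-∀

alt : ℕ → (ℕ → ℤ) → ℤ
alt n f = ∑ (suc n) (λ k → weight n k ℤ.* f k)

alt-difference : ∀ n (f g : ℕ → ℤ) → (∀ k → f (suc k) ≡ f k ℤ.+ g k) →
                 alt (suc n) f ≡ ℤ.- alt n g
alt-difference n f g step = begin
  alt (suc n) f
    ≡⟨ ∑-shift (suc n) _ ⟩
  f₀ ℤ.+ ∑ (suc n) (λ k → weight (suc n) (suc k) ℤ.* f (suc k))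
    ≡⟨ cong (ℤ._+_ f₀) (∑-cong (suc n) (λ k →
         trans (cong (ℤ._* f (suc k)) (weight-pascal n k))
               (distribute (weight n (suc k)) (weight n k) (f (suc k))))) ⟩
  f₀ ℤ.+ ∑ (suc n) (λ k → weight n (suc k) ℤ.* f (suc k) ℤ.- weight n k ℤ.* f (suc k))
    ≡⟨ cong (ℤ._+_ f₀) (∑-minus (suc n) _ _) ⟩
  f₀ ℤ.+ (∑ (suc n) (λ k → weight n (suc k) ℤ.* f (suc k)) ℤ.- shifted)
    ≡⟨ sym (ℤₚ.+-assoc f₀ _ _) ⟩
  (f₀ ℤ.+ ∑ (suc n) (λ k → weight n (suc k) ℤ.* f (suc k))) ℤ.- shifted
    ≡⟨ cong (ℤ._- shifted) (sym (∑-shift (suc n) _)) ⟩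
  ∑ (suc (suc n)) (λ k → weight n k ℤ.* f k) ℤ.- shifted
    ≡⟨ cong (ℤ._- shifted) (∑-pad _ top-vanishes (≤′-step ≤′-refl)) ⟩
  alt n f ℤ.- shifted
    ≡⟨ sym (⁻¹-anti-homo‿- shifted (alt n f)) ⟩
  ℤ.- (shifted ℤ.- alt n f)
    ≡⟨ cong ℤ.-_ (sym (∑-minus (suc n) _ _)) ⟩
  ℤ.- ∑ (suc n) (λ k → weight n k ℤ.* f (suc k) ℤ.- weight n k ℤ.* f k)
    ≡⟨ cong ℤ.-_ (∑-cong (suc n) (λ k →
         trans (cong (λ x → weight n k ℤ.* x ℤ.- weight n k ℤ.* f k) (step k))
               (cancel (weight n k) (f k) (g k)))) ⟩
  ℤ.- alt n g ∎
  where
  f₀ = weight n 0 ℤ.* f 0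
  shifted = ∑ (suc n) (λ k → weight n k ℤ.* f (suc k))
  top-vanishes : ∀ k → suc n ≤ k → weight n k ℤ.* f k ≡ 0ℤ
  top-vanishes k n<k = trans (cong (ℤ._* f k) (weight-vanish n k n<k)) (ℤₚ.*-zeroˡ (f k))
  distribute : ∀ a b x → (a ℤ.- b) ℤ.* x ≡ a ℤ.* x ℤ.- b ℤ.* x
  distribute = solve-∀
  cancel : ∀ w x y → w ℤ.* (x ℤ.+ y) ℤ.- w ℤ.* x ≡ w ℤ.* y
  cancel = solve-∀

-- ∑_{k=0}^{n} (-1)^k C(n,k) C(s+k,n) = (-1)^n : the sequence k ↦ C(s+k,n+1)
-- has forward difference k ↦ C(s+k,n), so each level flips the sign.
alt-binomial : ∀ s n → alt n (λ k → + ((s + k) C n)) ≡ -1ℤ ℤ.^ n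
alt-binomial s zero    = refl
alt-binomial s (suc n) = begin
  alt (suc n) (λ k → + ((s + k) C suc n)) ≡⟨ alt-difference n _ _ pascal ⟩
  ℤ.- alt n (λ k → + ((s + k) C n))       ≡⟨ cong ℤ.-_ (alt-binomial s n) ⟩
  ℤ.- (-1ℤ ℤ.^ n)                         ≡⟨ sym (ℤₚ.-1*i≡-i (-1ℤ ℤ.^ n)) ⟩
  -1ℤ ℤ.^ suc n                           ∎
  where
  pascal : ∀ k → + ((s + suc k) C suc n) ≡ + ((s + k) C suc n) ℤ.+ + ((s + k) C n)
  pascal k = begin
    + ((s + suc k) C suc n)                  ≡⟨ cong (λ m → + (m C suc n)) (+-comm s (suc k)) ⟩
    + (suc (k + s) C suc n)                  ≡⟨ cong (λ m → + (suc m C suc n)) (+-comm k s) ⟩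
    + (suc (s + k) C suc n)                  ≡⟨ cong +_ (sym (nCk+nC[k+1]≡[n+1]C[k+1] (s + k) n)) ⟩
    + ((s + k) C n + (s + k) C suc n)        ≡⟨ cong +_ (+-comm ((s + k) C n) _) ⟩
    + ((s + k) C suc n + (s + k) C n)        ≡⟨ ℤₚ.pos-+ ((s + k) C suc n) _ ⟩
    + ((s + k) C suc n) ℤ.+ + ((s + k) C n)  ∎

term : ℕ → ℕ → ℕ
term N k = (N C k) * ((N + k) C N)

term-vanish : ∀ N k → N < k → term N k ≡ 0
term-vanish N k N<k = cong (_* ((N + k) C N)) (k>n⇒nCk≡0 N<k)

alternating-term-sum : ∀ N → ∑ (suc N) (λ k → -1ℤ ℤ.^ k ℤ.* + term N k) ≡ -1ℤ ℤ.^ N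
alternating-term-sum N = trans (∑-cong (suc N) as-transform) (alt-binomial N N)
  where
  as-transform : ∀ k → -1ℤ ℤ.^ k ℤ.* + term N k ≡ weight N k ℤ.* + ((N + k) C N)
  as-transform k = trans (cong (-1ℤ ℤ.^ k ℤ.*_) (ℤₚ.pos-* (N C k) _))
                         (sym (ℤₚ.*-assoc (-1ℤ ℤ.^ k) _ _))

evenPart oddPart : ℕ → ℕ → ℕ
evenPart N M = sumTo M (λ l → term N (2 * l))
oddPart  N M = sumTo M (λ l → term N (2 * l + 1))

parity-difference : ∀ N M → N < 2 * M → + evenPart N M ℤ.- + oddPart N M ≡ -1ℤ ℤ.^ N
parity-difference N M N<2M = begin
  + evenPart N M ℤ.- + oddPart N M
    ≡⟨ cong₂ ℤ._-_ (∑-fromℕ M _) (∑-fromℕ M _) ⟩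
  ∑ M (λ l → + term N (2 * l)) ℤ.- ∑ M (λ l → + term N (2 * l + 1))
    ≡⟨ sym (∑-minus M _ _) ⟩
  ∑ M (λ l → + term N (2 * l) ℤ.- + term N (2 * l + 1))
    ≡⟨ ∑-cong M (λ l → sym (cong₂ ℤ._+_ (signed-even l) (signed-odd l))) ⟩
  ∑ M (λ l → signed (2 * l) ℤ.+ signed (2 * l + 1))
    ≡⟨ sym (∑-parity M signed) ⟩
  ∑ (2 * M) signed
    ≡⟨ ∑-pad signed beyond-N (≤⇒≤′ N<2M) ⟩
  ∑ (suc N) signed
    ≡⟨ alternating-term-sum N ⟩
  -1ℤ ℤ.^ N ∎
  where
  signed : ℕ → ℤ
  signed k = -1ℤ ℤ.^ k ℤ.* + term N k
  signed-even : ∀ l → signed (2 * l) ≡ + term N (2 * l)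
  signed-even l = trans (cong (ℤ._* + term N (2 * l)) (sign-even l)) (ℤₚ.*-identityˡ _)
  signed-odd : ∀ l → signed (2 * l + 1) ≡ ℤ.- + term N (2 * l + 1)
  signed-odd l = trans (cong (ℤ._* + term N (2 * l + 1)) (sign-odd l)) (ℤₚ.-1*i≡-i _)
  beyond-N : ∀ k → suc N ≤ k → signed k ≡ 0ℤ
  beyond-N k N<k = trans (cong (λ t → -1ℤ ℤ.^ k ℤ.* + t) (term-vanish N k N<k))
                         (ℤₚ.*-zeroʳ (-1ℤ ℤ.^ k))

difference-one : ∀ x y → + x ℤ.- + y ≡ 1ℤ → x ≡ y + 1
difference-one x y eq = ℤₚ.+-injective (begin
  + x                       ≡⟨ regroup (+ x) (+ y) ⟩
  + y ℤ.+ (+ x ℤ.- + y)     ≡⟨ cong (ℤ._+_ (+ y)) eq ⟩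
  + y ℤ.+ 1ℤ                ≡⟨ sym (ℤₚ.pos-+ y 1) ⟩
  + (y + 1)                 ∎)
  where
  regroup : ∀ a b → a ≡ b ℤ.+ (a ℤ.- b)
  regroup = solve-∀

2n+1<2[n+1] : ∀ n → 2 * n + 1 < 2 * suc n
2n+1<2[n+1] n = ≤-reflexive (index-identity n)
  where
  index-identity : ∀ m → 1 + (2 * m + 1) ≡ 2 * (1 + m)
  index-identity = ℕ-Solver.solve-∀

-- N = 2n: the even terms exceed the odd ones by 1; the odd term of
-- index 2n+1 lies beyond N, so n odd terms suffice.
even-splitting : ∀ n → evenPart (2 * n) (suc n) ≡ oddPart (2 * n) n + 1
even-splitting n = begin
  evenPart N (suc n)       ≡⟨ difference-one _ _ (trans (parity-difference N (suc n) N<2M) (sign-even n)) ⟩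
  oddPart N (suc n) + 1    ≡⟨ cong (λ t → oddPart N n + t + 1) (term-vanish N (N + 1) N<N+1) ⟩
  oddPart N n + 0 + 1      ≡⟨ cong (_+ 1) (+-identityʳ (oddPart N n)) ⟩
  oddPart N n + 1          ∎
  where
  N = 2 * n
  N<N+1 : N < N + 1
  N<N+1 = m<m+n N z<s
  N<2M : N < 2 * suc n
  N<2M = <-trans N<N+1 (2n+1<2[n+1] n)

odd-splitting : ∀ n → evenPart (2 * n + 1) (suc n) + 1 ≡ oddPart (2 * n + 1) (suc n)
odd-splitting n = sym (difference-one (oddPart N (suc n)) (evenPart N (suc n)) (begin
  O ℤ.- E          ≡⟨ sym (⁻¹-anti-homo‿- E O) ⟩
  ℤ.- (E ℤ.- O)    ≡⟨ cong ℤ.-_ (parity-difference N (suc n) (2n+1<2[n+1] n)) ⟩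
  ℤ.- (-1ℤ ℤ.^ N)  ≡⟨ cong ℤ.-_ (sign-odd n) ⟩
  1ℤ               ∎))
  where
  N = 2 * n + 1
  E = + evenPart N (suc n)
  O = + oddPart N (suc n)

term-at : ∀ N k m → m ≡ N + k → (N C k) * (m C N) ≡ term N k
term-at N k m m≡N+k = cong (λ u → (N C k) * (u C N)) m≡N+k

corollary3p8 : (n : ℕ) →
    (sumTo (1 + n) (λ l → ((2 * n) C (2 * l)) * ((2 * l + 2 * n) C (2 * n)))
      ≡ sumTo n (λ l → ((2 * n) C (2 * l + 1)) * ((2 * n + 2 * l + 1) C (2 * n))) + 1)
    × (sumTo (1 + n) (λ l → ((2 * n + 1) C (2 * l)) * ((2 * l + 2 * n + 1) C (2 * n + 1))) + 1
      ≡ sumTo (1 + n) (λ l → ((2 * n + 1) C (2 * l + 1)) * ((2 * n + 2 * l + 2) C (2 * n + 1))))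
corollary3p8 n =
  (begin
    sumTo (suc n) _            ≡⟨ sumTo-cong (suc n) (λ l → term-at N₀ (2 * l) _ (+-comm (2 * l) N₀)) ⟩
    evenPart N₀ (suc n)        ≡⟨ even-splitting n ⟩
    oddPart N₀ n + 1           ≡⟨ cong (_+ 1) (sumTo-cong n (λ l → sym (term-at N₀ (2 * l + 1) _ (+-assoc N₀ (2 * l) 1)))) ⟩
    sumTo n _ + 1              ∎)
  , (begin
    sumTo (suc n) _ + 1        ≡⟨ cong (_+ 1) (sumTo-cong (suc n) (λ l → term-at N₁ (2 * l) _ (odd-even-index n l))) ⟩
    evenPart N₁ (suc n) + 1    ≡⟨ odd-splitting n ⟩
    oddPart N₁ (suc n)         ≡⟨ sumTo-cong (suc n) (λ l → sym (term-at N₁ (2 * l + 1) _ (odd-odd-index n l))) ⟩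
    sumTo (suc n) _            ∎)
  where
  N₀ = 2 * n
  N₁ = 2 * n + 1
  odd-even-index : ∀ m l → 2 * l + 2 * m + 1 ≡ (2 * m + 1) + 2 * l
  odd-even-index = ℕ-Solver.solve-∀
  odd-odd-index : ∀ m l → 2 * m + 2 * l + 2 ≡ (2 * m + 1) + (2 * l + 1)
  odd-odd-index = ℕ-Solver.solve-∀
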